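{- Let $u\in\mathcal{M}$ be a balanced word. Then $\phi(u)=\phi(\omega(u))$ and $u\overset{\mathrm{bal}}{\sim}\omega(u)$.
   Context: $\Bbbk$ is a field of characteristic $0$. $\mathcal{M}$ is the free monoid on two letters $D,U$. $\mathcal{W}=\Bbbk\langle D,U\mid DU-UD=1\rangle$ is the Weyl algebra and $\phi:\mathcal{M}\to\mathcal{W}$ is the monoid morphism with $D\mapsto D$, $U\mapsto U$. A word is balanced if it has equally many $D$'s and $U$'s. $\omega:\mathcal{M}\to\mathcal{M}$ is the monoid anti-morphism with $\omega(U)=D,\ \omega(D)=U$ (reverse the word and swap each letter). A balanced commutation turns $pyxq$ into $pxyq$ for words $p,q$ and balanced words $x,y$; $\overset{\mathrm{bal}}{\sim}$ is the equivalence relation generated by (finite sequences of) balanced commutations. -}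

module Defs where

open import Level using (Level; _⊔_)
open import Algebra.Bundles using (CommutativeRing)
open import Data.Nat using (ℕ; zero; suc)
open import Data.List using (List; []; _∷_; _++_; reverse; map; concatMap)
open import Data.List.Properties using (≡-dec)
open import Data.Product using (_×_; _,_; ∃; ∃-syntax)
open import Relation.Nullary using (¬_; yes; no)
open import Relation.Binary.PropositionalEquality using (_≡_; refl)
open import Relation.Binary.Construct.Closure.Equivalence using (EqClosure)

module _ {c ℓ : Level} (R : CommutativeRing c ℓ) where
  open CommutativeRing R hiding (zero)

  natCast : ℕ → Carrier
  natCast zero = 0#
  natCast (suc n) = 1# + natCast n

  record IsFieldChar0 : Set (c ⊔ ℓ) where
    field
      1≉0      : ¬ (1# ≈ 0#)
      inverse  : ∀ x → ¬ (x ≈ 0#) → ∃[ y ] (x * y ≈ 1#)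
      char0    : ∀ n → natCast n ≈ 0# → n ≡ zero

data Letter : Set where
  D U : Letter

letter-dec : (a b : Letter) → Relation.Nullary.Dec (a ≡ b)
letter-dec D D = yes refl
letter-dec D U = no (λ ())
letter-dec U D = no (λ ())
letter-dec U U = yes refl

Word : Set
Word = List Letter

word-dec : (v w : Word) → Relation.Nullary.Dec (v ≡ w)
word-dec = ≡-dec letter-dec

countD : Word → ℕ
countD [] = 0
countD (D ∷ w) = suc (countD w)
countD (U ∷ w) = countD w

countU : Word → ℕ
countU [] = 0
countU (U ∷ w) = suc (countU w)
countU (D ∷ w) = countU w

Balanced : Word → Set
Balanced w = countD w ≡ countU w

swap : Letter → Letter
swap D = U
swap U = D

ω : Word → Word
ω w = reverse (map swap w)

data BalComm : Word → Word → Set where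
  balComm : (p x y q : Word) → Balanced x → Balanced y →
            BalComm (p ++ y ++ x ++ q) (p ++ x ++ y ++ q)

_∼bal_ : Word → Word → Set
_∼bal_ = EqClosure BalComm

-- The Weyl algebra W = k⟨D,U⟩ / (DU - UD - 1), presented concretely.
-- Elements of the free algebra k⟨D,U⟩ are represented by finite formal
-- sums Σ cᵢ wᵢ (lists of coefficient/word pairs); two such are equal in
-- k⟨D,U⟩ iff all word coefficients agree.  Two elements are equal in W
-- iff their difference lies in the two-sided ideal generated by
-- DU - UD - 1, i.e. equals Σᵢ cᵢ pᵢ (DU - UD - 1) qᵢ in k⟨D,U⟩.

module Weyl {c ℓ : Level} (R : CommutativeRing c ℓ) where
  open CommutativeRing R hiding (zero)

  FreeAlg : Set c
  FreeAlg = List (Carrier × Word)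

  coeff : FreeAlg → Word → Carrier
  coeff [] w = 0#
  coeff ((a , v) ∷ f) w with word-dec v w
  ... | yes _ = a + coeff f w
  ... | no  _ = coeff f w

  _≈F_ : FreeAlg → FreeAlg → Set ℓ
  f ≈F g = ∀ w → coeff f w ≈ coeff g w

  negF : FreeAlg → FreeAlg
  negF = map (λ { (a , v) → (- a , v) })

  gen : Carrier × Word × Word → FreeAlg
  gen (a , p , q) =
    (a , p ++ D ∷ U ∷ q) ∷ (- a , p ++ U ∷ D ∷ q) ∷ (- a , p ++ q) ∷ []

  InIdeal : FreeAlg → Set (c ⊔ ℓ)
  InIdeal f = ∃[ ts ] (f ≈F concatMap gen ts)

  _≈W_ : FreeAlg → FreeAlg → Set (c ⊔ ℓ)
  f ≈W g = InIdeal (f ++ negF g)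

  φ : Word → FreeAlg
  φ w = (1# , w) ∷ []

{-# OPTIONS --safe #-}
-- A balanced word is a v ā w with ā the letter other than a and v, w balanced, and
-- ω (a v ā w) = ω(w) a ω(v) ā.  Hence u ~ ω u for every congruence ~ on words under which
-- balanced words commute: move the block a v ā past w, then recurse into w and v.  For φ, every balanced word is a polynomial in
-- N = UD in the Weyl algebra, since DU = N + 1 gives D Nᵏ U = (N + 1)ᵏ⁺¹ and U Nᵏ D = N (N − 1)ᵏ;
-- and [N, w] = (#U w − #D w) w shows that N, hence every polynomial in N, commutes with balanced
-- words.
module Submission where

open import Defs
open import Level using (Level; _⊔_)
open import Algebra.Bundles using (CommutativeRing)
open import Data.Product using (_×_; _,_)
open import Data.List using ([]; _∷_; _++_; reverse; map)
open import Data.List.Properties using (++-assoc; ++-identityʳ; map-++)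
open import Relation.Binary using (Rel; IsEquivalence; Setoid)
open import Relation.Binary.PropositionalEquality using (_≡_)

module BalancedWords where

  open import Data.Nat using (ℕ; zero; suc; _+_)
  open import Relation.Binary.PropositionalEquality
    using (refl; sym; trans; cong; cong₂; subst; subst₂; module ≡-Reasoning)
  open import Data.Nat.Properties using (+-suc; suc-injective)
  open import Data.List.Properties using (reverse-++; ++-monoid)
  open import Tactic.MonoidSolver using (solve)
  import Relation.Binary.Construct.Closure.Equivalence as EqClosure
  import Relation.Binary.Reasoning.Setoid as SetoidReasoning

  countD-++ : ∀ v w → countD (v ++ w) ≡ countD v + countD w
  countD-++ []      w = refl
  countD-++ (D ∷ v) w = cong suc (countD-++ v w)
  countD-++ (U ∷ v) w = countD-++ v w

  countU-++ : ∀ v w → countU (v ++ w) ≡ countU v + countU w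
  countU-++ []      w = refl
  countU-++ (D ∷ v) w = countU-++ v w
  countU-++ (U ∷ v) w = cong suc (countU-++ v w)

  count : Letter → Word → ℕ
  count D = countD
  count U = countU

  data Bal : Word → Set where
    nil  : Bal []
    node : ∀ a {v w} → Bal v → Bal w → Bal (a ∷ v ++ swap a ∷ w)

  Bal⇒Balanced : ∀ {u} → Bal u → Balanced u
  Bal⇒Balanced nil = refl
  Bal⇒Balanced (node D {v} {w} bv bw) = begin
    suc (countD (v ++ U ∷ w))        ≡⟨ cong suc (countD-++ v (U ∷ w)) ⟩
    suc (countD v + countD w)        ≡⟨ cong suc (cong₂ _+_ (Bal⇒Balanced bv) (Bal⇒Balanced bw)) ⟩
    suc (countU v + countU w)        ≡⟨ +-suc (countU v) (countU w) ⟨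
    countU v + suc (countU w)        ≡⟨ countU-++ v (U ∷ w) ⟨
    countU (v ++ U ∷ w)              ∎
    where open ≡-Reasoning
  Bal⇒Balanced (node U {v} {w} bv bw) = begin
    countD (v ++ D ∷ w)              ≡⟨ countD-++ v (D ∷ w) ⟩
    countD v + suc (countD w)        ≡⟨ +-suc (countD v) (countD w) ⟩
    suc (countD v + countD w)        ≡⟨ cong suc (cong₂ _+_ (Bal⇒Balanced bv) (Bal⇒Balanced bw)) ⟩
    suc (countU v + countU w)        ≡⟨ cong suc (countU-++ v (D ∷ w)) ⟨
    suc (countU (v ++ D ∷ w))        ∎
    where open ≡-Reasoning

  data Chain (e : Letter) : ℕ → Word → Set where
    last : ∀ {w} → Bal w → Chain e zero w
    _◂_  : ∀ {k w v} → Bal w → Chain e k v → Chain e (suc k) (w ++ e ∷ v)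

  Chain⇒Bal : ∀ {e w} → Chain e zero w → Bal w
  Chain⇒Bal (last b) = b

  -- o w₀ (swap o) w₁ is again in Bal, so prepending o merges the first two blocks.
  Chain-cons : ∀ o {k u} → Chain (swap o) (suc k) u → Chain (swap o) k (o ∷ u)
  Chain-cons o (b₀ ◂ last b₁) = last (node o b₀ b₁)
  Chain-cons o (_◂_ {w = w₀} b₀ (_◂_ {w = w₁} b₁ c)) =
    subst (Chain (swap o) _) (cong (o ∷_) (++-assoc w₀ (swap o ∷ w₁) _)) (node o b₀ b₁ ◂ c)

  count⇒Chain : ∀ e k u → count e u ≡ k + count (swap e) u → Chain e k u
  count⇒Chain e zero    []      _  = last nil
  count⇒Chain D (suc k) []      ()
  count⇒Chain U (suc k) []      ()
  count⇒Chain D (suc k) (D ∷ u) h = nil ◂ count⇒Chain D k u (suc-injective h)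
  count⇒Chain U (suc k) (U ∷ u) h = nil ◂ count⇒Chain U k u (suc-injective h)
  count⇒Chain D zero    (D ∷ u) h = last (Chain⇒Bal (Chain-cons D (count⇒Chain U 1 u (sym h))))
  count⇒Chain U zero    (U ∷ u) h = last (Chain⇒Bal (Chain-cons U (count⇒Chain D 1 u (sym h))))
  count⇒Chain D k       (U ∷ u) h = Chain-cons U (count⇒Chain D (suc k) u (trans h (+-suc k _)))
  count⇒Chain U k       (D ∷ u) h = Chain-cons D (count⇒Chain U (suc k) u (trans h (+-suc k _)))

  Balanced⇒Bal : ∀ {u} → Balanced u → Bal u
  Balanced⇒Bal {u} b = Chain⇒Bal (count⇒Chain D zero u b)

  ω-++ : ∀ x y → ω (x ++ y) ≡ ω y ++ ω x
  ω-++ x y = trans (cong reverse (map-++ swap x y)) (reverse-++ (map swap x) (map swap y))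

  swap-involutive : ∀ a → swap (swap a) ≡ a
  swap-involutive D = refl
  swap-involutive U = refl

  ω-bracket : ∀ a v w → ω (a ∷ v ++ swap a ∷ w) ≡ (ω w ++ a ∷ []) ++ ω v ++ swap a ∷ []
  ω-bracket a v w = begin
    ω (a ∷ v ++ swap a ∷ w)
      ≡⟨ ω-++ (a ∷ []) (v ++ swap a ∷ w) ⟩
    ω (v ++ swap a ∷ w) ++ swap a ∷ []
      ≡⟨ cong (_++ swap a ∷ []) (ω-++ v (swap a ∷ w)) ⟩
    (ω (swap a ∷ w) ++ ω v) ++ swap a ∷ []
      ≡⟨ cong (λ x → (x ++ ω v) ++ swap a ∷ []) (ω-++ (swap a ∷ []) w) ⟩
    ((ω w ++ swap (swap a) ∷ []) ++ ω v) ++ swap a ∷ []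
      ≡⟨ cong (λ b → ((ω w ++ b ∷ []) ++ ω v) ++ swap a ∷ []) (swap-involutive a) ⟩
    ((ω w ++ a ∷ []) ++ ω v) ++ swap a ∷ []
      ≡⟨ ++-assoc (ω w ++ a ∷ []) (ω v) (swap a ∷ []) ⟩
    (ω w ++ a ∷ []) ++ ω v ++ swap a ∷ []
      ∎
    where open ≡-Reasoning

  module _ {ℓ} {_~_ : Rel Word ℓ} (~-isEquivalence : IsEquivalence _~_)
           (~-cong : ∀ p q {s t} → s ~ t → (p ++ s ++ q) ~ (p ++ t ++ q))
           (~-comm : ∀ x y → Balanced x → Balanced y → (x ++ y) ~ (y ++ x)) where

    ~-setoid : Setoid _ _
    ~-setoid = record { isEquivalence = ~-isEquivalence }

    Bal⇒~ω : ∀ {u} → Bal u → u ~ ω u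
    Bal⇒~ω nil = IsEquivalence.refl ~-isEquivalence
    Bal⇒~ω (node a {v} {w} bv bw) = begin
      a ∷ v ++ swap a ∷ w
        ≡⟨ ++-assoc (a ∷ v) (swap a ∷ []) w ⟨
      (a ∷ v ++ swap a ∷ []) ++ w
        ≈⟨ ~-comm _ w (Bal⇒Balanced (node a bv nil)) (Bal⇒Balanced bw) ⟩
      w ++ a ∷ v ++ swap a ∷ []
        ≈⟨ ~-cong [] (a ∷ v ++ swap a ∷ []) (Bal⇒~ω bw) ⟩
      ω w ++ a ∷ v ++ swap a ∷ []
        ≡⟨ ++-assoc (ω w) (a ∷ []) (v ++ swap a ∷ []) ⟨
      (ω w ++ a ∷ []) ++ v ++ swap a ∷ []
        ≈⟨ ~-cong (ω w ++ a ∷ []) (swap a ∷ []) (Bal⇒~ω bv) ⟩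
      (ω w ++ a ∷ []) ++ ω v ++ swap a ∷ []
        ≡⟨ ω-bracket a v w ⟨
      ω (a ∷ v ++ swap a ∷ w)
        ∎
      where open SetoidReasoning ~-setoid

  BalComm-cong : ∀ p q {s t} → BalComm s t → BalComm (p ++ s ++ q) (p ++ t ++ q)
  BalComm-cong p q (balComm p₁ x y q₁ bx by) =
    subst₂ BalComm (reassoc y x) (reassoc x y) (balComm (p ++ p₁) x y (q₁ ++ q) bx by)
    where
    reassoc : ∀ x y → (p ++ p₁) ++ x ++ y ++ q₁ ++ q ≡ p ++ (p₁ ++ x ++ y ++ q₁) ++ q
    reassoc x y = solve (++-monoid Letter)

  ∼bal-cong : ∀ p q {s t} → s ∼bal t → (p ++ s ++ q) ∼bal (p ++ t ++ q)
  ∼bal-cong p q = EqClosure.gmap (λ s → p ++ s ++ q) (BalComm-cong p q)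

  ∼bal-comm : ∀ x y → Balanced x → Balanced y → (x ++ y) ∼bal (y ++ x)
  ∼bal-comm x y bx by =
    subst₂ _∼bal_ (cong (x ++_) (++-identityʳ y)) (cong (y ++_) (++-identityʳ x))
      (EqClosure.return (balComm [] y x [] by bx))

  Bal⇒∼balω : ∀ {u} → Bal u → u ∼bal ω u
  Bal⇒∼balω = Bal⇒~ω (EqClosure.isEquivalence BalComm) ∼bal-cong ∼bal-comm

module WeylAlgebra {c ℓ : Level} (R : CommutativeRing c ℓ) where

  open BalancedWords
  open CommutativeRing R hiding (zero)
  open Weyl R
  open import Algebra.Properties.Ring ring using (-0#≈0#)
  open import Algebra.Properties.AbelianGroup +-abelianGroup
    using (⁻¹-anti-homo‿-; ⁻¹-∙-comm; //-rightDividesˡ; //-rightDividesʳ)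
  open import Algebra.Properties.CommutativeSemigroup +-commutativeSemigroup using (interchange)
  open import Data.Nat using (ℕ; zero; suc)
  open import Data.Empty using (⊥-elim)
  open import Data.Product using (∃; map₂)
  open import Data.List using (concatMap)
  open import Data.List.Properties
    using (++-cancelˡ; ++-cancelʳ; map-∘; concatMap-cong; concatMap-map; map-concatMap; concatMap-++; ++-monoid)
  open import Algebra.Bundles using (Monoid)
  open import Algebra.Definitions.RawMagma (Monoid.rawMagma (++-monoid Letter)) using (_,_)
  open import Data.List.Relation.Binary.Prefix.Heterogeneous.Properties using (prefix?)
  open import Data.List.Relation.Binary.Suffix.Heterogeneous.Properties using (suffix?)
  open import Data.List.Relation.Binary.Prefix.Propositional.Properties using (Prefix-as-∣ˡ; ∣ˡ-as-Prefix)
  open import Data.List.Relation.Binary.Suffix.Propositional.Properties using (Suffix-as-∣ʳ; ∣ʳ-as-Suffix)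
  open import Function using (_∘_; Injective)
  open import Relation.Nullary using (Dec; yes; no)
  import Relation.Nullary.Decidable as Dec
  open import Relation.Binary.PropositionalEquality as ≡ using (_≢_)
  import Relation.Binary.Reasoning.Setoid as SetoidReasoning

  mapW : (Word → Word) → FreeAlg → FreeAlg
  mapW t = map (map₂ t)

  lmul : Word → FreeAlg → FreeAlg
  lmul p = mapW (p ++_)

  rmul : Word → FreeAlg → FreeAlg
  rmul q = mapW (_++ q)

  mapW-negF : ∀ t f → mapW t (negF f) ≡ negF (mapW t f)
  mapW-negF t []      = ≡.refl
  mapW-negF t (_ ∷ f) = ≡.cong (_ ∷_) (mapW-negF t f)

  ≡⇒≈F : ∀ {f g} → f ≡ g → f ≈F g
  ≡⇒≈F ≡.refl _ = refl

  coeff-++ : ∀ f g w → coeff (f ++ g) w ≈ coeff f w + coeff g w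
  coeff-++ []            g w = sym (+-identityˡ _)
  coeff-++ ((a , v) ∷ f) g w with word-dec v w
  ... | yes _ = trans (+-congˡ (coeff-++ f g w)) (sym (+-assoc a _ _))
  ... | no  _ = coeff-++ f g w

  coeff-negF : ∀ f w → coeff (negF f) w ≈ - coeff f w
  coeff-negF []            w = sym -0#≈0#
  coeff-negF ((a , v) ∷ f) w with word-dec v w
  ... | yes _ = trans (+-congˡ (coeff-negF f w)) (⁻¹-∙-comm a _)
  ... | no  _ = coeff-negF f w

  coeff-difference : ∀ f g w → coeff (f ++ negF g) w ≈ coeff f w - coeff g w
  coeff-difference f g w = trans (coeff-++ f (negF g) w) (+-congˡ (coeff-negF g w))

  ++-≈F : ∀ f f′ g g′ → f ≈F f′ → g ≈F g′ → (f ++ g) ≈F (f′ ++ g′)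
  ++-≈F f f′ g g′ f≈f′ g≈g′ w =
    trans (coeff-++ f g w) (trans (+-cong (f≈f′ w) (g≈g′ w)) (sym (coeff-++ f′ g′ w)))

  negF-≈F : ∀ f g → f ≈F g → negF f ≈F negF g
  negF-≈F f g f≈g w = trans (coeff-negF f w) (trans (-‿cong (f≈g w)) (sym (coeff-negF g w)))

  coeff-mapW-image : ∀ {t} → Injective _≡_ _≡_ t → ∀ f v → coeff (mapW t f) (t v) ≈ coeff f v
  coeff-mapW-image {t} inj []            v = refl
  coeff-mapW-image {t} inj ((a , x) ∷ f) v with word-dec (t x) (t v) | word-dec x v
  ... | yes _   | yes _   = +-congˡ (coeff-mapW-image inj f v)
  ... | yes tx≡tv | no x≢v = ⊥-elim (x≢v (inj tx≡tv))
  ... | no tx≢tv  | yes x≡v = ⊥-elim (tx≢tv (≡.cong t x≡v))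
  ... | no _    | no _    = coeff-mapW-image inj f v

  coeff-mapW-∉ : ∀ {t w} f → (∀ v → t v ≢ w) → coeff (mapW t f) w ≈ 0#
  coeff-mapW-∉         []            w∉ = refl
  coeff-mapW-∉ {t} {w} ((a , x) ∷ f) w∉ with word-dec (t x) w
  ... | yes tx≡w = ⊥-elim (w∉ x tx≡w)
  ... | no  _    = coeff-mapW-∉ f w∉

  mapW-≈F : ∀ {t} → Injective _≡_ _≡_ t → (∀ w → Dec (∃ λ v → t v ≡ w)) →
            ∀ f g → f ≈F g → mapW t f ≈F mapW t g
  mapW-≈F inj image? f g f≈g w with image? w
  ... | yes (v , ≡.refl) =
    trans (coeff-mapW-image inj f v) (trans (f≈g v) (sym (coeff-mapW-image inj g v)))
  ... | no w∉ =
    trans (coeff-mapW-∉ f (λ v e → w∉ (v , e))) (sym (coeff-mapW-∉ g (λ v e → w∉ (v , e))))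

  -- The outer map′ only converts the library's record _∣ˡ_ (resp. _∣ʳ_) into a Σ-type.
  prefix-of? : ∀ p w → Dec (∃ λ v → p ++ v ≡ w)
  prefix-of? p w = Dec.map′ (λ (v , e) → v , e) (λ (v , e) → v , e)
    (Dec.map′ Prefix-as-∣ˡ ∣ˡ-as-Prefix (prefix? letter-dec p w))

  suffix-of? : ∀ q w → Dec (∃ λ v → v ++ q ≡ w)
  suffix-of? q w = Dec.map′ (λ (v , e) → v , e) (λ (v , e) → v , e)
    (Dec.map′ Suffix-as-∣ʳ ∣ʳ-as-Suffix (suffix? letter-dec q w))

  lmul-≈F : ∀ p f g → f ≈F g → lmul p f ≈F lmul p g
  lmul-≈F p = mapW-≈F (++-cancelˡ p _ _) (prefix-of? p)

  rmul-≈F : ∀ q f g → f ≈F g → rmul q f ≈F rmul q g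
  rmul-≈F q = mapW-≈F (++-cancelʳ q _ _) (suffix-of? q)

  InIdeal-≈F : ∀ f g → f ≈F g → InIdeal g → InIdeal f
  InIdeal-≈F f g f≈g (ts , g≈) = ts , λ w → trans (f≈g w) (g≈ w)

  InIdeal-[] : InIdeal []
  InIdeal-[] = [] , λ _ → refl

  InIdeal-++ : ∀ f g → InIdeal f → InIdeal g → InIdeal (f ++ g)
  InIdeal-++ f g (ts , f≈) (ts′ , g≈) = ts ++ ts′ , λ w →
    trans (++-≈F f (concatMap gen ts) g (concatMap gen ts′) f≈ g≈ w)
          (≡⇒≈F (≡.sym (concatMap-++ gen ts ts′)) w)

  InIdeal-map : (t : Carrier × Word → Carrier × Word) (k : Carrier × Word × Word → Carrier × Word × Word) →
                (∀ x → map t (gen x) ≡ gen (k x)) → (∀ f g → f ≈F g → map t f ≈F map t g) →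
                ∀ f → InIdeal f → InIdeal (map t f)
  InIdeal-map t k t∘gen t-≈F f (ts , f≈) = map k ts , λ w →
    trans (t-≈F f (concatMap gen ts) f≈ w) (≡⇒≈F map-t-generators w)
    where
    map-t-generators : map t (concatMap gen ts) ≡ concatMap gen (map k ts)
    map-t-generators = ≡.trans (map-concatMap t gen ts)
      (≡.trans (concatMap-cong t∘gen ts) (≡.sym (concatMap-map gen k ts)))

  InIdeal-negF : ∀ f → InIdeal f → InIdeal (negF f)
  InIdeal-negF = InIdeal-map _ (λ (a , p , q) → (- a , p , q)) (λ _ → ≡.refl) negF-≈F

  lmul-gen : ∀ p a p′ q → lmul p (gen (a , p′ , q)) ≡ gen (a , p ++ p′ , q)
  lmul-gen p a p′ q
    rewrite ++-assoc p p′ (D ∷ U ∷ q) | ++-assoc p p′ (U ∷ D ∷ q) | ++-assoc p p′ q = ≡.refl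

  rmul-gen : ∀ q a p q′ → rmul q (gen (a , p , q′)) ≡ gen (a , p , q′ ++ q)
  rmul-gen q a p q′
    rewrite ++-assoc p (D ∷ U ∷ q′) q | ++-assoc p (U ∷ D ∷ q′) q | ++-assoc p q′ q = ≡.refl

  -- _≈W_ computes to an existential, from which f and g cannot be inferred; the record makes them inferable.
  infix 4 _≃_
  record _≃_ (f g : FreeAlg) : Set (c ⊔ ℓ) where
    constructor ≈W⇒≃
    field ≃⇒≈W : f ≈W g
  open _≃_ public

  ≈F⇒≃ : ∀ {f g} → f ≈F g → f ≃ g
  ≈F⇒≃ {f} {g} f≈g = ≈W⇒≃ (InIdeal-≈F (f ++ negF g) [] f-g≈0 InIdeal-[])
    where
    f-g≈0 : (f ++ negF g) ≈F []
    f-g≈0 w = trans (coeff-difference f g w) (trans (+-congʳ (f≈g w)) (-‿inverseʳ _))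

  ≡⇒≃ : ∀ {f g} → f ≡ g → f ≃ g
  ≡⇒≃ {f} {g} f≡g = ≈F⇒≃ (≡⇒≈F {f} {g} f≡g)

  ≃-refl : ∀ {f} → f ≃ f
  ≃-refl = ≡⇒≃ ≡.refl

  ≃-sym : ∀ {f g} → f ≃ g → g ≃ f
  ≃-sym {f} {g} (≈W⇒≃ i) =
    ≈W⇒≃ (InIdeal-≈F (g ++ negF f) (negF (f ++ negF g)) coefficients (InIdeal-negF (f ++ negF g) i))
    where
    coefficients : (g ++ negF f) ≈F negF (f ++ negF g)
    coefficients w = begin
      coeff (g ++ negF f) w              ≈⟨ coeff-difference g f w ⟩
      coeff g w - coeff f w              ≈⟨ ⁻¹-anti-homo‿- (coeff f w) (coeff g w) ⟨
      - (coeff f w - coeff g w)          ≈⟨ -‿cong (coeff-difference f g w) ⟨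
      - coeff (f ++ negF g) w            ≈⟨ coeff-negF (f ++ negF g) w ⟨
      coeff (negF (f ++ negF g)) w       ∎
      where open SetoidReasoning setoid

  ≃-trans : ∀ {f g h} → f ≃ g → g ≃ h → f ≃ h
  ≃-trans {f} {g} {h} (≈W⇒≃ i) (≈W⇒≃ j) =
    ≈W⇒≃ (InIdeal-≈F (f ++ negF h) ((f ++ negF g) ++ (g ++ negF h)) coefficients
                     (InIdeal-++ (f ++ negF g) (g ++ negF h) i j))
    where
    coefficients : (f ++ negF h) ≈F ((f ++ negF g) ++ (g ++ negF h))
    coefficients w = begin
      coeff (f ++ negF h) w
        ≈⟨ coeff-difference f h w ⟩
      coeff f w - coeff h w
        ≈⟨ +-congʳ (//-rightDividesˡ (coeff g w) (coeff f w)) ⟨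
      (coeff f w - coeff g w) + coeff g w - coeff h w
        ≈⟨ +-assoc _ (coeff g w) _ ⟩
      (coeff f w - coeff g w) + (coeff g w - coeff h w)
        ≈⟨ +-cong (coeff-difference f g w) (coeff-difference g h w) ⟨
      coeff (f ++ negF g) w + coeff (g ++ negF h) w
        ≈⟨ coeff-++ (f ++ negF g) (g ++ negF h) w ⟨
      coeff ((f ++ negF g) ++ (g ++ negF h)) w
        ∎
      where open SetoidReasoning setoid

  ≃-isEquivalence : IsEquivalence _≃_
  ≃-isEquivalence = record { refl = ≃-refl ; sym = ≃-sym ; trans = ≃-trans }

  ≃-setoid : Setoid c (c ⊔ ℓ)
  ≃-setoid = record { isEquivalence = ≃-isEquivalence }

  ≃-++ : ∀ {f f′ g g′} → f ≃ f′ → g ≃ g′ → (f ++ g) ≃ (f′ ++ g′)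
  ≃-++ {f} {f′} {g} {g′} (≈W⇒≃ i) (≈W⇒≃ j) =
    ≈W⇒≃ (InIdeal-≈F ((f ++ g) ++ negF (f′ ++ g′)) ((f ++ negF f′) ++ (g ++ negF g′)) coefficients
                     (InIdeal-++ (f ++ negF f′) (g ++ negF g′) i j))
    where
    coefficients : ((f ++ g) ++ negF (f′ ++ g′)) ≈F ((f ++ negF f′) ++ (g ++ negF g′))
    coefficients w = begin
      coeff ((f ++ g) ++ negF (f′ ++ g′)) w
        ≈⟨ coeff-difference (f ++ g) (f′ ++ g′) w ⟩
      coeff (f ++ g) w - coeff (f′ ++ g′) w
        ≈⟨ +-cong (coeff-++ f g w) (-‿cong (coeff-++ f′ g′ w)) ⟩
      (coeff f w + coeff g w) - (coeff f′ w + coeff g′ w)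
        ≈⟨ +-congˡ (⁻¹-∙-comm (coeff f′ w) (coeff g′ w)) ⟨
      (coeff f w + coeff g w) + (- coeff f′ w + - coeff g′ w)
        ≈⟨ interchange _ _ _ _ ⟩
      (coeff f w - coeff f′ w) + (coeff g w - coeff g′ w)
        ≈⟨ +-cong (coeff-difference f f′ w) (coeff-difference g g′ w) ⟨
      coeff (f ++ negF f′) w + coeff (g ++ negF g′) w
        ≈⟨ coeff-++ (f ++ negF f′) (g ++ negF g′) w ⟨
      coeff ((f ++ negF f′) ++ (g ++ negF g′)) w
        ∎
      where open SetoidReasoning setoid

  ≃-negF : ∀ {f g} → f ≃ g → negF f ≃ negF g
  ≃-negF {f} {g} (≈W⇒≃ i) =
    ≈W⇒≃ (≡.subst InIdeal (map-++ _ f (negF g)) (InIdeal-negF (f ++ negF g) i))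

  ≃-mapW : ∀ t → (∀ f g → f ≈F g → mapW t f ≈F mapW t g) →
           (k : Carrier × Word × Word → Carrier × Word × Word) → (∀ x → mapW t (gen x) ≡ gen (k x)) →
           ∀ {f g} → f ≃ g → mapW t f ≃ mapW t g
  ≃-mapW t t-≈F k t∘gen {f} {g} (≈W⇒≃ i) =
    ≈W⇒≃ (≡.subst InIdeal mapW-difference (InIdeal-map (map₂ t) k t∘gen t-≈F (f ++ negF g) i))
    where
    mapW-difference : mapW t (f ++ negF g) ≡ mapW t f ++ negF (mapW t g)
    mapW-difference = ≡.trans (map-++ _ f (negF g)) (≡.cong (mapW t f ++_) (mapW-negF t g))

  ≃-lmul : ∀ p {f g} → f ≃ g → lmul p f ≃ lmul p g
  ≃-lmul p = ≃-mapW (p ++_) (lmul-≈F p)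
    (λ (a , p′ , q) → a , p ++ p′ , q) (λ (a , p′ , q) → lmul-gen p a p′ q)

  ≃-rmul : ∀ q {f g} → f ≃ g → rmul q f ≃ rmul q g
  ≃-rmul q = ≃-mapW (_++ q) (rmul-≈F q)
    (λ (a , p , q′) → a , p , q′ ++ q) (λ (a , p , q′) → rmul-gen q a p q′)

  ≃-context : ∀ p q {f g} → f ≃ g → mapW (λ s → p ++ s ++ q) f ≃ mapW (λ s → p ++ s ++ q) g
  ≃-context p q {f} {g} f≃g =
    ≡.subst₂ _≃_ (≡.sym (map-∘ f)) (≡.sym (map-∘ g)) (≃-lmul p (≃-rmul q f≃g))

  DU≃UD+1 : ∀ p q → φ (p ++ D ∷ U ∷ q) ≃ φ (p ++ U ∷ D ∷ q) ++ φ (p ++ q)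
  DU≃UD+1 p q = ≈W⇒≃ ((1# , p , q) ∷ [] , ≡⇒≈F (≡.sym (++-identityʳ (gen (1# , p , q)))))

  ≃-++-comm : ∀ f g → (f ++ g) ≃ (g ++ f)
  ≃-++-comm f g = ≈F⇒≃ λ w → trans (coeff-++ f g w) (trans (+-comm _ _) (sym (coeff-++ g f w)))

  ≃-merge : ∀ a b v → ((a , v) ∷ (b , v) ∷ []) ≃ ((a + b , v) ∷ [])
  ≃-merge a b v = ≈F⇒≃ λ w → trans (coeff-++ ((a , v) ∷ []) ((b , v) ∷ []) w) (singletons w)
    where
    singletons : ∀ w → coeff ((a , v) ∷ []) w + coeff ((b , v) ∷ []) w ≈ coeff ((a + b , v) ∷ []) w
    singletons w with word-dec v w
    ... | yes _ = trans (+-cong (+-identityʳ a) (+-identityʳ b)) (sym (+-identityʳ _))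
    ... | no  _ = +-identityʳ 0#

  ++-negF-cancelʳ : ∀ f h → ((f ++ h) ++ negF h) ≈F f
  ++-negF-cancelʳ f h w = begin
    coeff ((f ++ h) ++ negF h) w      ≈⟨ coeff-difference (f ++ h) h w ⟩
    coeff (f ++ h) w - coeff h w      ≈⟨ +-congʳ (coeff-++ f h w) ⟩
    coeff f w + coeff h w - coeff h w ≈⟨ //-rightDividesʳ (coeff h w) (coeff f w) ⟩
    coeff f w                         ∎
    where open SetoidReasoning setoid

  ≃-cancelʳ : ∀ {f g} h → (f ++ h) ≃ (g ++ h) → f ≃ g
  ≃-cancelʳ {f} {g} h f+h≃g+h = begin
    f                    ≈⟨ ≈F⇒≃ (++-negF-cancelʳ f h) ⟨
    (f ++ h) ++ negF h   ≈⟨ ≃-++ f+h≃g+h ≃-refl ⟩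
    (g ++ h) ++ negF h   ≈⟨ ≈F⇒≃ (++-negF-cancelʳ g h) ⟩
    g                    ∎
    where open SetoidReasoning ≃-setoid

  ≃-moveʳ : ∀ {f g h} → f ≃ (g ++ h) → g ≃ (f ++ negF h)
  ≃-moveʳ {f} {g} {h} f≃g+h = begin
    g                    ≈⟨ ≈F⇒≃ (++-negF-cancelʳ g h) ⟨
    (g ++ h) ++ negF h   ≈⟨ ≃-++ (≃-sym f≃g+h) ≃-refl ⟩
    f ++ negF h          ∎
    where open SetoidReasoning ≃-setoid

  UD : Word
  UD = U ∷ D ∷ []

  #D #U : Word → Carrier
  #D w = natCast R (countD w)
  #U w = natCast R (countU w)

  -- [UD, w] = (#U w − #D w) w, with the negative terms moved across.
  UD-commutator : ∀ w → (1# , UD ++ w) ∷ (#D w , w) ∷ [] ≃ (1# , w ++ UD) ∷ (#U w , w) ∷ []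
  UD-commutator []      = ≃-refl
  UD-commutator (U ∷ w) = begin
    (1# , U ∷ D ∷ U ∷ w) ∷ (#D w , U ∷ w) ∷ []
      ≈⟨ ≃-++ (DU≃UD+1 (U ∷ []) w) ≃-refl ⟩
    (1# , U ∷ U ∷ D ∷ w) ∷ (1# , U ∷ w) ∷ (#D w , U ∷ w) ∷ []
      ≈⟨ ≃-++ (≃-refl {φ (U ∷ U ∷ D ∷ w)}) (≃-++-comm (φ (U ∷ w)) _) ⟩
    (1# , U ∷ U ∷ D ∷ w) ∷ (#D w , U ∷ w) ∷ (1# , U ∷ w) ∷ []
      ≈⟨ ≃-++ (≃-lmul (U ∷ []) (UD-commutator w)) ≃-refl ⟩
    (1# , U ∷ w ++ UD) ∷ (#U w , U ∷ w) ∷ (1# , U ∷ w) ∷ []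
      ≈⟨ ≃-++ (≃-refl {φ (U ∷ w ++ UD)}) (≃-++-comm _ (φ (U ∷ w))) ⟩
    (1# , U ∷ w ++ UD) ∷ (1# , U ∷ w) ∷ (#U w , U ∷ w) ∷ []
      ≈⟨ ≃-++ (≃-refl {φ (U ∷ w ++ UD)}) (≃-merge 1# (#U w) (U ∷ w)) ⟩
    (1# , U ∷ w ++ UD) ∷ (1# + #U w , U ∷ w) ∷ []
      ∎
    where open SetoidReasoning ≃-setoid
  UD-commutator (D ∷ w) = begin
    (1# , U ∷ D ∷ D ∷ w) ∷ (1# + #D w , D ∷ w) ∷ []
      ≈⟨ ≃-++ (≃-refl {φ (U ∷ D ∷ D ∷ w)}) (≃-merge 1# (#D w) (D ∷ w)) ⟨
    (1# , U ∷ D ∷ D ∷ w) ∷ (1# , D ∷ w) ∷ (#D w , D ∷ w) ∷ []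
      ≈⟨ ≃-++ (DU≃UD+1 [] (D ∷ w)) ≃-refl ⟨
    (1# , D ∷ U ∷ D ∷ w) ∷ (#D w , D ∷ w) ∷ []
      ≈⟨ ≃-lmul (D ∷ []) (UD-commutator w) ⟩
    (1# , D ∷ w ++ UD) ∷ (#U w , D ∷ w) ∷ []
      ∎
    where open SetoidReasoning ≃-setoid

  UD-comm : ∀ {w} → Balanced w → φ (UD ++ w) ≃ φ (w ++ UD)
  UD-comm {w} balanced = ≃-cancelʳ ((#D w , w) ∷ []) (begin
    φ (UD ++ w) ++ (#D w , w) ∷ []
      ≈⟨ UD-commutator w ⟩
    (1# , w ++ UD) ∷ (#U w , w) ∷ []
      ≡⟨ ≡.cong (λ n → (1# , w ++ UD) ∷ (natCast R n , w) ∷ []) balanced ⟨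
    φ (w ++ UD) ++ (#D w , w) ∷ []
      ∎)
    where open SetoidReasoning ≃-setoid

  UD^ : ℕ → Word
  UD^ zero    = []
  UD^ (suc k) = UD ++ UD^ k

  infix 4 _∈k[UD]
  infixl 6 _⊕_
  data _∈k[UD] : FreeAlg → Set (c ⊔ ℓ) where
    power : ∀ k → φ (UD^ k) ∈k[UD]
    _⊕_   : ∀ {f g} → f ∈k[UD] → g ∈k[UD] → f ++ g ∈k[UD]
    ⊖_    : ∀ {f} → f ∈k[UD] → negF f ∈k[UD]
    via   : ∀ {f g} → f ≃ g → g ∈k[UD] → f ∈k[UD]

  ∈k[UD]-mapW : ∀ t → (∀ {f g} → f ≃ g → mapW t f ≃ mapW t g) → (∀ k → φ (t (UD^ k)) ∈k[UD]) →
                ∀ {f} → f ∈k[UD] → mapW t f ∈k[UD]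
  ∈k[UD]-mapW t t-≃ t-powers (power k)           = t-powers k
  ∈k[UD]-mapW t t-≃ t-powers (_⊕_ {f} {g} p q)   =
    ≡.subst _∈k[UD] (≡.sym (map-++ _ f g)) (∈k[UD]-mapW t t-≃ t-powers p ⊕ ∈k[UD]-mapW t t-≃ t-powers q)
  ∈k[UD]-mapW t t-≃ t-powers (⊖_ {f} p)          =
    ≡.subst _∈k[UD] (≡.sym (mapW-negF t f)) (⊖ ∈k[UD]-mapW t t-≃ t-powers p)
  ∈k[UD]-mapW t t-≃ t-powers (via f≃g p)         = via (t-≃ f≃g) (∈k[UD]-mapW t t-≃ t-powers p)

  UD·-∈k[UD] : ∀ {f} → f ∈k[UD] → lmul UD f ∈k[UD]
  UD·-∈k[UD] = ∈k[UD]-mapW (UD ++_) (≃-lmul UD) (λ k → power (suc k))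

  DU·-∈k[UD] : ∀ {x} → φ x ∈k[UD] → φ (D ∷ U ∷ x) ∈k[UD]
  DU·-∈k[UD] {x} p = via (DU≃UD+1 [] x) (UD·-∈k[UD] p ⊕ p)

  D-UD^-U-∈k[UD] : ∀ {w} → φ w ∈k[UD] → ∀ k → φ (D ∷ UD^ k ++ U ∷ w) ∈k[UD]
  D-UD^-U-∈k[UD] p zero    = DU·-∈k[UD] p
  D-UD^-U-∈k[UD] p (suc k) = DU·-∈k[UD] (D-UD^-U-∈k[UD] p k)

  U-UD^-D-∈k[UD] : ∀ {w} → φ w ∈k[UD] → ∀ k → φ (U ∷ UD^ k ++ D ∷ w) ∈k[UD]
  U-UD^-D-∈k[UD] p zero    = UD·-∈k[UD] p
  U-UD^-D-∈k[UD] {w} p (suc k) =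
    via (≃-moveʳ (DU≃UD+1 (U ∷ []) (UD^ k ++ D ∷ w))) (UD·-∈k[UD] IH ⊕ ⊖ IH)
    where
    IH : φ (U ∷ UD^ k ++ D ∷ w) ∈k[UD]
    IH = U-UD^-D-∈k[UD] p k

  Bal⇒∈k[UD] : ∀ {u} → Bal u → φ u ∈k[UD]
  Bal⇒∈k[UD] nil = power 0
  Bal⇒∈k[UD] (node D {v} {w} bv bw) =
    ∈k[UD]-mapW _ (≃-context (D ∷ []) (U ∷ w)) (D-UD^-U-∈k[UD] (Bal⇒∈k[UD] bw)) (Bal⇒∈k[UD] bv)
  Bal⇒∈k[UD] (node U {v} {w} bv bw) =
    ∈k[UD]-mapW _ (≃-context (U ∷ []) (D ∷ w)) (U-UD^-D-∈k[UD] (Bal⇒∈k[UD] bw)) (Bal⇒∈k[UD] bv)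

  UD^-comm : ∀ {y} → Balanced y → ∀ k → φ (UD^ k ++ y) ≃ φ (y ++ UD^ k)
  UD^-comm {y} balanced zero    = ≡⇒≃ (≡.cong φ (≡.sym (++-identityʳ y)))
  UD^-comm {y} balanced (suc k) = begin
    φ (UD ++ UD^ k ++ y)    ≈⟨ ≃-lmul UD (UD^-comm balanced k) ⟩
    φ (UD ++ y ++ UD^ k)    ≈⟨ ≃-rmul (UD^ k) (UD-comm balanced) ⟩
    φ ((y ++ UD) ++ UD^ k)  ≡⟨ ≡.cong φ (++-assoc y UD (UD^ k)) ⟩
    φ (y ++ UD ++ UD^ k)    ∎
    where open SetoidReasoning ≃-setoid

  ∈k[UD]-comm : ∀ {y f} → Balanced y → f ∈k[UD] → rmul y f ≃ lmul y f
  ∈k[UD]-comm balanced (power k) = UD^-comm balanced k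
  ∈k[UD]-comm {y} balanced (_⊕_ {f} {g} p q) =
    ≡.subst₂ _≃_ (≡.sym (map-++ _ f g)) (≡.sym (map-++ _ f g))
      (≃-++ (∈k[UD]-comm balanced p) (∈k[UD]-comm balanced q))
  ∈k[UD]-comm {y} balanced (⊖_ {f} p) =
    ≡.subst₂ _≃_ (≡.sym (mapW-negF (_++ y) f)) (≡.sym (mapW-negF (y ++_) f))
      (≃-negF (∈k[UD]-comm balanced p))
  ∈k[UD]-comm {y} balanced (via {f} {g} f≃g p) = begin
    rmul y f   ≈⟨ ≃-rmul y f≃g ⟩
    rmul y g   ≈⟨ ∈k[UD]-comm balanced p ⟩
    lmul y g   ≈⟨ ≃-lmul y f≃g ⟨
    lmul y f   ∎
    where open SetoidReasoning ≃-setoid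

  balanced-φ-comm : ∀ x y → Balanced x → Balanced y → φ (x ++ y) ≃ φ (y ++ x)
  balanced-φ-comm x y bx by = ∈k[UD]-comm {y} by (Bal⇒∈k[UD] (Balanced⇒Bal {x} bx))

  Bal⇒φ≃φω : ∀ {u} → Bal u → φ u ≃ φ (ω u)
  Bal⇒φ≃φω = Bal⇒~ω φ-isEquivalence (λ p q → ≃-lmul p ∘ ≃-rmul q) balanced-φ-comm
    where
    φ-isEquivalence : IsEquivalence (λ s t → φ s ≃ φ t)
    φ-isEquivalence = record { refl = ≃-refl ; sym = ≃-sym ; trans = ≃-trans }

theorem2p3 : {c ℓ : Level} (k : CommutativeRing c ℓ) → IsFieldChar0 k →
             (u : Word) → Balanced u →
             Weyl._≈W_ k (Weyl.φ k u) (Weyl.φ k (ω u)) × (u ∼bal ω u)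
theorem2p3 k _ u balanced = ≃⇒≈W (Bal⇒φ≃φω bal) , Bal⇒∼balω bal
  where
  open BalancedWords
  open WeylAlgebra k
  bal : Bal u
  bal = Balanced⇒Bal balanced
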